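{- Let $D$ be a digraph. There exists a multipacking of $D$ of maximum size that contains every source of $D$.
   Context: Digraphs are finite. For vertices $u,v$, $d(u,v)$ is the length of a shortest directed path from $u$ to $v$ ($\infty$ if none); $B^+_r(v)=\{u: d(v,u)\le r\}$. A multipacking of $D$ is a set $S\subseteq V(D)$ such that for every vertex $v$ and every integer $r\ge 1$, $|B^+_r(v)\cap S|\le r$. A source is a vertex with no in-neighbor. -}

module Defs where

open import Data.Nat using (ℕ; zero; suc; _≤_)
open import Data.Fin using (Fin)
open import Data.Fin.Subset using (Subset; _∈_; ∣_∣)
open import Data.List using (List; length)
open import Data.List.Relation.Unary.All using (All)
open import Data.List.Relation.Unary.Unique.Propositional using (Unique)
open import Data.Product using (Σ; ∃; _×_)
open import Relation.Nullary using (¬_; Dec)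
open import Level using (0ℓ)

record Digraph : Set₁ where
  field
    n   : ℕ
    Arc : Fin n → Fin n → Set
    arc? : (u v : Fin n) → Dec (Arc u v)

open Digraph public

data Walk (D : Digraph) : Fin (n D) → Fin (n D) → ℕ → Set where
  here : ∀ {u} → Walk D u u zero
  step : ∀ {u w v k} → Arc D u w → Walk D w v k → Walk D u v (suc k)

-- d(v,u) ≤ r  (a shortest directed path has length ≤ r iff some walk of length ≤ r exists)
dist≤ : (D : Digraph) → Fin (n D) → Fin (n D) → ℕ → Set
dist≤ D v u r = ∃ λ k → k ≤ r × Walk D v u k

InBall : (D : Digraph) → ℕ → Fin (n D) → Fin (n D) → Set
InBall D r v u = dist≤ D v u r

-- |B⁺_r(v) ∩ S| ≤ r, phrased as: every duplicate-free list of vertices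
-- of B⁺_r(v) ∩ S has length ≤ r.
BallCount≤ : (D : Digraph) → Subset (n D) → Fin (n D) → ℕ → Set
BallCount≤ D S v r =
  (xs : List (Fin (n D))) → Unique xs →
  All (λ u → InBall D r v u × u ∈ S) xs → length xs ≤ r

IsMultipacking : (D : Digraph) → Subset (n D) → Set
IsMultipacking D S = (v : Fin (n D)) (r : ℕ) → 1 ≤ r → BallCount≤ D S v r

IsMaxMultipacking : (D : Digraph) → Subset (n D) → Set
IsMaxMultipacking D S =
  IsMultipacking D S × ((T : Subset (n D)) → IsMultipacking D T → ∣ T ∣ ≤ ∣ S ∣)

IsSource : (D : Digraph) → Fin (n D) → Set
IsSource D v = (u : Fin (n D)) → ¬ Arc D u v

module Submission where

-- Let S be a maximum multipacking and s a source outside S. A ball around a vertex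
-- v ≠ s never contains s, so only the balls centred at s can be violated when s is
-- added. If some vertex of S is reachable from s, let x be a nearest one and trade x
-- for s: a ball B⁺_r(s) either misses S (r < d(s,x)) and then meets the new set in s
-- alone, or contains x, whose place s takes. Otherwise S ∪ {s} is a larger
-- multipacking (radii r ≥ |V| constrain nothing, so only walks shorter than |V|
-- matter). Neither move removes a source of S, so the sources are inserted one by one.

open import Defs

open import Data.Nat using (ℕ; zero; suc; _≤_; _<_; z≤n; s≤s; _≤?_; _<?_)
open import Data.Nat.Properties
  using (≤-<-trans; ≤-reflexive; ≤-trans; m<1+n⇒m<n∨m≡n; m<1+n⇒m≤n; ≮⇒≥; anyUpTo?; allUpTo?;
         module ≤-Reasoning)
open import Data.Fin as Fin using (Fin; zero; suc)
open import Data.Fin.Properties using (any?; all?)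
open import Data.Fin.Subset using (⊥; Subset; _∈_; _∉_; ∣_∣; inside; outside; ⁅_⁆; _∪_; _-_)
open import Data.Fin.Subset.Properties
  using (_∈?_; ∉⊥; x∈⁅x⁆; x∈⁅y⁆⇒x≡y; x∈p∪q⁻; p⊆p∪q; q⊆p∪q; ∪-identityʳ; p─⊥≡p; p─q⊆p; x∈p∧x≢y⇒x∈p-y;
         ∣p∣≤n; ∣p∣≤∣p∪q∣; anySubset?)
open import Data.List using (List; []; _∷_; length; filter; allFin)
open import Data.Vec using (_∷_; here; there)
open import Data.List.Properties using (filter-notAll; length-tabulate)
open import Data.List.Relation.Unary.All as All using (All; []; _∷_)
import Data.List.Relation.Unary.Any as Any
open import Data.List.Relation.Unary.AllPairs using ([]; _∷_)
open import Data.List.Relation.Unary.Unique.Propositional using (Unique)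
import Data.List.Relation.Unary.Unique.Propositional.Properties as Unique
open import Data.List.Membership.Propositional.Properties using (∈-filter⁺; ∈-filter⁻; ∈-allFin)
open import Data.List.Relation.Binary.Subset.Propositional using (_⊆_)
open import Data.List.Membership.Propositional using () renaming (_∈_ to _∈ₗ_)
open import Data.Product using (Σ; ∃; _×_; _,_; proj₁; proj₂; map₁; map₂)
open import Data.Sum using (_⊎_; inj₁; inj₂; [_,_]′)
open import Function using (_∘_; id)
open import Level using (Level)
open import Relation.Binary.Definitions using (DecidableEquality)
open import Relation.Binary.PropositionalEquality
  using (_≡_; _≢_; refl; sym; cong; subst; module ≡-Reasoning)
open import Relation.Nullary using (Dec; yes; no; ¬_; contradiction)
open import Relation.Nullary.Decidable as Dec using (¬?; _×-dec_; _→-dec_)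
open import Relation.Unary using (Pred; Decidable)

private
  variable
    a p q : Level
    A : Set a
    m : ℕ

module _ (_≟_ : DecidableEquality A) where

  private
    _≢?_ : (u v : A) → Dec (u ≢ v)
    u ≢? v = ¬? (u ≟ v)

  Unique⇒length≤ : ∀ {xs ys : List A} → Unique xs → xs ⊆ ys → length xs ≤ length ys
  Unique⇒length≤ [] _ = z≤n
  Unique⇒length≤ {x ∷ xs} {ys} (x∉xs ∷ uxs) xs⊆ys = begin
    suc (length xs)                   ≤⟨ s≤s (Unique⇒length≤ uxs xs⊆ys-x) ⟩
    suc (length (filter (x ≢?_) ys))  ≤⟨ filter-notAll (x ≢?_) ys x∈ys ⟩
    length ys                         ∎
    where
    open ≤-Reasoning
    xs⊆ys-x : xs ⊆ filter (x ≢?_) ys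
    xs⊆ys-x z∈xs = ∈-filter⁺ (x ≢?_) (xs⊆ys (Any.there z∈xs)) (All.lookup x∉xs z∈xs)
    x∈ys = Any.map (λ x≡z x≢z → x≢z x≡z) (xs⊆ys (Any.here refl))

  Unique⇒length≤1 : ∀ {s} {xs : List A} → Unique xs → All (_≡ s) xs → length xs ≤ 1
  Unique⇒length≤1 {s} uxs xs≡s =
    Unique⇒length≤ {ys = s ∷ []} uxs (λ z∈xs → Any.here (All.lookup xs≡s z∈xs))

  -- The witness is x ∷ (xs without s): s is traded for x, every other element for itself.
  exchange : ∀ {P : Pred A p} {Q : Pred A q} {s x} {xs} →
             Unique xs → All P xs → Q x → (∀ {z} → P z → z ≢ s → Q z × z ≢ x) →
             ∃ λ ys → Unique ys × All Q ys × length xs ≤ length ys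
  exchange {Q = Q} {s = s} {x} {xs} uxs Pxs Qx trade =
    x ∷ zs , All.tabulate (λ z∈zs → proj₂ (traded z∈zs) ∘ sym) ∷ Unique.filter⁺ (_≢? s) uxs
           , Qx ∷ All.tabulate (proj₁ ∘ traded)
           , Unique⇒length≤ uxs xs⊆s∷zs
    where
    zs = filter (_≢? s) xs
    traded : ∀ {z} → z ∈ₗ zs → Q z × z ≢ x
    traded z∈zs = let z∈xs , z≢s = ∈-filter⁻ (_≢? s) {xs = xs} z∈zs
                  in trade (All.lookup Pxs z∈xs) z≢s
    xs⊆s∷zs : xs ⊆ s ∷ zs
    xs⊆s∷zs {z} z∈xs with z ≟ s
    ... | yes z≡s = Any.here z≡s
    ... | no z≢s = Any.there (∈-filter⁺ (_≢? s) z∈xs z≢s)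

Unique⇒length≤n : ∀ {xs : List (Fin m)} → Unique xs → length xs ≤ m
Unique⇒length≤n {xs = xs} uxs =
  subst (length xs ≤_) (length-tabulate id) (Unique⇒length≤ Fin._≟_ uxs (λ {i} _ → ∈-allFin i))

x∉p⇒∣p∪⁅x⁆∣≡1+∣p∣ : ∀ {x : Fin m} {p} → x ∉ p → ∣ p ∪ ⁅ x ⁆ ∣ ≡ suc ∣ p ∣
x∉p⇒∣p∪⁅x⁆∣≡1+∣p∣ {x = zero} {p = inside ∷ p} x∉p = contradiction here x∉p
x∉p⇒∣p∪⁅x⁆∣≡1+∣p∣ {x = zero} {p = outside ∷ p} _ = cong (suc ∘ ∣_∣) (∪-identityʳ p)
x∉p⇒∣p∪⁅x⁆∣≡1+∣p∣ {x = suc x} {p = inside ∷ p} x∉p = cong suc (x∉p⇒∣p∪⁅x⁆∣≡1+∣p∣ (x∉p ∘ there))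
x∉p⇒∣p∪⁅x⁆∣≡1+∣p∣ {x = suc x} {p = outside ∷ p} x∉p = x∉p⇒∣p∪⁅x⁆∣≡1+∣p∣ (x∉p ∘ there)

x∈p⇒∣p∣≡1+∣p-x∣ : ∀ {x : Fin m} {p} → x ∈ p → ∣ p ∣ ≡ suc ∣ p - x ∣
x∈p⇒∣p∣≡1+∣p-x∣ {x = zero} {p = inside ∷ p} here = cong (suc ∘ ∣_∣) (sym (p─⊥≡p p))
x∈p⇒∣p∣≡1+∣p-x∣ {x = suc x} {p = inside ∷ p} (there x∈p) = cong suc (x∈p⇒∣p∣≡1+∣p-x∣ x∈p)
x∈p⇒∣p∣≡1+∣p-x∣ {x = suc x} {p = outside ∷ p} (there x∈p) = x∈p⇒∣p∣≡1+∣p-x∣ x∈p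

x∉p-x : ∀ {x : Fin m} {p} → x ∉ p - x
x∉p-x {x = zero} {p = _ ∷ p} ()
x∉p-x {x = suc x} {p = _ ∷ p} (there x∈p-x) = x∉p-x x∈p-x

x∈p∪⁅y⁆∧x≢y⇒x∈p : ∀ {x y : Fin m} {p} → x ∈ p ∪ ⁅ y ⁆ → x ≢ y → x ∈ p
x∈p∪⁅y⁆∧x≢y⇒x∈p {p = p} x∈p∪⁅y⁆ x≢y =
  [ id , (λ x∈⁅y⁆ → contradiction (x∈⁅y⁆⇒x≡y _ x∈⁅y⁆) x≢y) ]′ (x∈p∪q⁻ p _ x∈p∪⁅y⁆)

maximum-exists : ∀ {P : Pred (Subset m) p} → Decidable P → ∃ P →
                 ∃ λ S → P S × (∀ T → P T → ∣ T ∣ ≤ ∣ S ∣)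
maximum-exists {m = m} {P = P} P? (T₀ , PT₀) = search m (λ T _ → ∣p∣≤n T)
  where
  search : ∀ k → (∀ T → P T → ∣ T ∣ ≤ k) → ∃ λ S → P S × (∀ T → P T → ∣ T ∣ ≤ ∣ S ∣)
  search k bound with anySubset? (λ T → P? T ×-dec k ≤? ∣ T ∣)
  ... | yes (S , PS , k≤∣S∣) = S , PS , λ T PT → ≤-trans (bound T PT) k≤∣S∣
  search zero    _ | no none = contradiction (T₀ , PT₀ , z≤n) none
  search (suc k) _ | no none = search k (λ T PT → ≮⇒≥ (λ k<∣T∣ → none (T , PT , k<∣T∣)))

least-or-none : ∀ {P : Pred ℕ p} → Decidable P → ∀ m →
                (∀ {j} → j < m → ¬ P j) ⊎ ∃ λ j → P j × (∀ {i} → i < j → ¬ P i)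
least-or-none P? zero = inj₁ λ ()
least-or-none P? (suc m) with least-or-none P? m
... | inj₂ least = inj₂ least
... | inj₁ none with P? m
...   | yes Pm = inj₂ (m , Pm , none)
...   | no ¬Pm = inj₁ λ j<1+m → [ none , (λ { refl → ¬Pm }) ]′ (m<1+n⇒m<n∨m≡n j<1+m)

module _ (D : Digraph) where

  private
    N = n D

  walk? : ∀ u v k → Dec (Walk D u v k)
  walk? u v zero = Dec.map′ (λ { refl → here }) (λ { here → refl }) (u Fin.≟ v)
  walk? u v (suc k) =
    Dec.map′ (λ (w , uw , wv) → step uw wv) (λ { (step uw wv) → _ , uw , wv })
             (any? λ w → arc? D u w ×-dec walk? w v k)

  inBall? : ∀ r v u → Dec (InBall D r v u)
  inBall? r v u =
    Dec.map′ (map₂ (map₁ m<1+n⇒m≤n)) (map₂ (map₁ s≤s)) (anyUpTo? (walk? v u) (suc r))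

  ballCount≤? : ∀ S v r → Dec (BallCount≤ D S v r)
  ballCount≤? S v r = Dec.map′ sound complete (length ball ≤? r)
    where
    inBall∩S? : Decidable (λ u → InBall D r v u × u ∈ S)
    inBall∩S? u = inBall? r v u ×-dec u ∈? S
    ball = filter inBall∩S? (allFin N)
    sound : length ball ≤ r → BallCount≤ D S v r
    sound ≤r xs uxs xs⊆ = ≤-trans (Unique⇒length≤ Fin._≟_ uxs xs⊆ball) ≤r
      where
      xs⊆ball : xs ⊆ ball
      xs⊆ball u∈xs = ∈-filter⁺ inBall∩S? (∈-allFin _) (All.lookup xs⊆ u∈xs)
    complete : BallCount≤ D S v r → length ball ≤ r
    complete count = count ball (Unique.filter⁺ inBall∩S? (Unique.allFin⁺ N))
                                (All.tabulate (proj₂ ∘ ∈-filter⁻ inBall∩S? {xs = allFin N}))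

  ballCount≤-large : ∀ {S v r} → N ≤ r → BallCount≤ D S v r
  ballCount≤-large N≤r xs uxs _ = ≤-trans (Unique⇒length≤n uxs) N≤r

  isMultipacking? : ∀ S → Dec (IsMultipacking D S)
  isMultipacking? S = all? λ v →
    Dec.map′ extend restrict (allUpTo? (λ r → 1 ≤? r →-dec ballCount≤? S v r) N)
    where
    Packs : Fin N → ℕ → Set
    Packs v r = 1 ≤ r → BallCount≤ D S v r
    extend : ∀ {v} → (∀ {r} → r < N → Packs v r) → ∀ r → Packs v r
    extend small r with r <? N
    ... | yes r<N = small r<N
    ... | no r≮N = λ _ → ballCount≤-large (≮⇒≥ r≮N)
    restrict : ∀ {v} → (∀ r → Packs v r) → ∀ {r} → r < N → Packs v r
    restrict packs {r} _ = packs r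

  walk-to-source : ∀ {u s k} → IsSource D s → Walk D u s k → u ≡ s
  walk-to-source src here = refl
  walk-to-source src (step uw ws) with refl ← walk-to-source src ws = contradiction uw (src _)

  inBall-source : ∀ {r v s} → IsSource D s → InBall D r v s → v ≡ s
  inBall-source src (_ , _ , vs) = walk-to-source src vs

  ballCount≤-only-centre : ∀ {T v r} → 1 ≤ r → (∀ {u} → InBall D r v u → u ∈ T → u ≡ v) →
                           BallCount≤ D T v r
  ballCount≤-only-centre 1≤r centre xs uxs xs⊆ =
    ≤-trans (Unique⇒length≤1 Fin._≟_ uxs (All.map (λ (inB , u∈T) → centre inB u∈T) xs⊆)) 1≤r

  ballCount≤-exchange : ∀ {S T v r s x} → BallCount≤ D S v r → InBall D r v x → x ∈ S →
                        (∀ {u} → InBall D r v u → u ∈ T → u ≢ s → u ∈ S × u ≢ x) →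
                        BallCount≤ D T v r
  ballCount≤-exchange count inB-x x∈S trade xs uxs xs⊆ =
    let ys , uys , ys⊆ , xs≤ys = exchange Fin._≟_ uxs xs⊆ (inB-x , x∈S)
                                   (λ (inB , u∈T) u≢s → map₁ (inB ,_) (trade inB u∈T u≢s))
    in ≤-trans xs≤ys (count ys uys ys⊆)

  source-exchange : ∀ {S T s} → IsSource D s → IsMultipacking D S →
                    (∀ {u} → u ∈ T → u ≢ s → u ∈ S) →
                    (∀ r → 1 ≤ r → BallCount≤ D T s r) → IsMultipacking D T
  source-exchange {S} {T} {s} src mpS T∖s⊆S atSource v r 1≤r with v Fin.≟ s
  ... | yes refl = atSource r 1≤r
  ... | no v≢s = λ xs uxs xs⊆ →
    mpS v r 1≤r xs uxs (All.map (λ (inB , u∈T) → inB , inS inB u∈T) xs⊆)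
    where
    inS : ∀ {u} → InBall D r v u → u ∈ T → u ∈ S
    inS inB u∈T = T∖s⊆S u∈T (λ { refl → v≢s (inBall-source src inB) })

  Reaches : Subset N → Fin N → ℕ → Set
  Reaches S s j = ∃ λ y → y ∈ S × Walk D s y j

  reaches? : ∀ S s → Decidable (Reaches S s)
  reaches? S s j = any? λ y → y ∈? S ×-dec walk? s y j

  add-far-source : ∀ {S s} → IsSource D s → IsMultipacking D S →
                   (∀ {j} → j < N → ¬ Reaches S s j) → IsMultipacking D (S ∪ ⁅ s ⁆)
  add-far-source {S} {s} src mpS far = source-exchange src mpS x∈p∪⁅y⁆∧x≢y⇒x∈p atSource
    where
    atSource : ∀ r → 1 ≤ r → BallCount≤ D (S ∪ ⁅ s ⁆) s r
    atSource r 1≤r with r <? N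
    ... | no r≮N = ballCount≤-large (≮⇒≥ r≮N)
    ... | yes r<N = ballCount≤-only-centre 1≤r centre
      where
      centre : ∀ {u} → InBall D r s u → u ∈ S ∪ ⁅ s ⁆ → u ≡ s
      centre {u} (k , k≤r , su) u∈T with u Fin.≟ s
      ... | yes u≡s = u≡s
      ... | no u≢s = contradiction (u , x∈p∪⁅y⁆∧x≢y⇒x∈p u∈T u≢s , su) (far (≤-<-trans k≤r r<N))

  exchange-nearest : ∀ {S s x j} → IsSource D s → IsMultipacking D S → x ∈ S → Walk D s x j →
                     (∀ {i} → i < j → ¬ Reaches S s i) → IsMultipacking D ((S - x) ∪ ⁅ s ⁆)
  exchange-nearest {S} {s} {x} {j} src mpS x∈S sx nearest =
    source-exchange src mpS (λ u∈T u≢s → p─q⊆p S _ (x∈p∪⁅y⁆∧x≢y⇒x∈p u∈T u≢s)) atSource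
    where
    atSource : ∀ r → 1 ≤ r → BallCount≤ D ((S - x) ∪ ⁅ s ⁆) s r
    atSource r 1≤r with inBall? r s x
    ... | yes inB-x = ballCount≤-exchange (mpS s r 1≤r) inB-x x∈S trade
      where
      trade : ∀ {u} → InBall D r s u → u ∈ (S - x) ∪ ⁅ s ⁆ → u ≢ s → u ∈ S × u ≢ x
      trade _ u∈T u≢s = let u∈S-x = x∈p∪⁅y⁆∧x≢y⇒x∈p u∈T u≢s in
        p─q⊆p S _ u∈S-x , λ { refl → x∉p-x u∈S-x }
    ... | no x∉B = ballCount≤-only-centre 1≤r centre
      where
      centre : ∀ {u} → InBall D r s u → u ∈ (S - x) ∪ ⁅ s ⁆ → u ≡ s
      centre {u} (k , k≤r , su) u∈T with u Fin.≟ s | k <? j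
      ... | yes u≡s | _ = u≡s
      ... | no u≢s | yes k<j =
        contradiction (u , p─q⊆p S _ (x∈p∪⁅y⁆∧x≢y⇒x∈p u∈T u≢s) , su) (nearest k<j)
      ... | no _ | no k≮j = contradiction (j , ≤-trans (≮⇒≥ k≮j) k≤r , sx) x∉B

  isMaxMultipacking-≤ : ∀ {S T} → IsMaxMultipacking D S → IsMultipacking D T → ∣ S ∣ ≤ ∣ T ∣ →
                        IsMaxMultipacking D T
  isMaxMultipacking-≤ (_ , maxS) mpT ∣S∣≤∣T∣ = mpT , λ U mpU → ≤-trans (maxS U mpU) ∣S∣≤∣T∣

  insert-source : ∀ {S s} → IsMaxMultipacking D S → IsSource D s →
                  ∃ λ S′ → IsMaxMultipacking D S′ × s ∈ S′ ×
                           (∀ {u} → IsSource D u → u ∈ S → u ∈ S′)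
  insert-source {S} {s} maxS@(mpS , _) src with s ∈? S
  ... | yes s∈S = S , maxS , s∈S , λ _ u∈S → u∈S
  ... | no s∉S with least-or-none (reaches? S s) N
  ...   | inj₁ far = S ∪ ⁅ s ⁆
                   , isMaxMultipacking-≤ maxS (add-far-source src mpS far) (∣p∣≤∣p∪q∣ S _)
                   , q⊆p∪q S _ (x∈⁅x⁆ s)
                   , λ _ → p⊆p∪q _
  ...   | inj₂ (j , (x , x∈S , sx) , nearest) = (S - x) ∪ ⁅ s ⁆
                   , isMaxMultipacking-≤ maxS (exchange-nearest src mpS x∈S sx nearest)
                                         (≤-reflexive ∣S∣≡∣T∣)
                   , q⊆p∪q _ _ (x∈⁅x⁆ s)
                   , λ srcu u∈S → p⊆p∪q _ (x∈p∧x≢y⇒x∈p-y u∈S (λ { refl → x≢source srcu }))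
    where
    x≢source : ¬ IsSource D x
    x≢source srcx = s∉S (subst (_∈ S) (sym (walk-to-source srcx sx)) x∈S)
    ∣S∣≡∣T∣ : ∣ S ∣ ≡ ∣ (S - x) ∪ ⁅ s ⁆ ∣
    ∣S∣≡∣T∣ = begin
      ∣ S ∣               ≡⟨ x∈p⇒∣p∣≡1+∣p-x∣ x∈S ⟩
      suc ∣ S - x ∣       ≡⟨ sym (x∉p⇒∣p∪⁅x⁆∣≡1+∣p∣ (s∉S ∘ p─q⊆p S _)) ⟩
      ∣ (S - x) ∪ ⁅ s ⁆ ∣ ∎
      where open ≡-Reasoning

  empty-isMultipacking : IsMultipacking D ⊥
  empty-isMultipacking _ _ _ [] _ _ = z≤n
  empty-isMultipacking _ _ _ (_ ∷ _) _ ((_ , u∈⊥) ∷ _) = contradiction u∈⊥ ∉⊥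

  maxMultipacking-containing-sources :
    ∀ vs → ∃ λ S → IsMaxMultipacking D S × All (λ v → IsSource D v → v ∈ S) vs
  maxMultipacking-containing-sources [] =
    let S , maxS = maximum-exists isMultipacking? (⊥ , empty-isMultipacking) in S , maxS , []
  maxMultipacking-containing-sources (v ∷ vs)
    with maxMultipacking-containing-sources vs | all? (λ u → ¬? (arc? D u v))
  ... | S , maxS , vs⊆S | no ¬src = S , maxS , (λ src → contradiction src ¬src) ∷ vs⊆S
  ... | S , maxS , vs⊆S | yes src =
    let S′ , maxS′ , v∈S′ , kept = insert-source maxS src
    in S′ , maxS′ , (λ _ → v∈S′) ∷ All.map (λ v⊆S srcu → kept srcu (v⊆S srcu)) vs⊆S

lemma13 : (D : Digraph) →
    Σ (Subset (n D)) λ S →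
    IsMaxMultipacking D S × ((v : Fin (n D)) → IsSource D v → v ∈ S)
lemma13 D = let S , maxS , sources⊆S = maxMultipacking-containing-sources D (allFin (n D))
            in S , maxS , λ v → All.lookup sources⊆S (∈-allFin v)
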